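{- If $m,n$ are positive integers, then $\mu^{ - }(K_m\,\square\, K_n)=m+n-1$.
   Context: $K_m$ is the complete graph on $m$ vertices and $\square$ is the Cartesian product of graphs: $V(G\square H)=V(G)\times V(H)$, with $(g,h)(g',h')$ an edge iff ($g=g'$ and $hh'\in E(H)$) or ($gg'\in E(G)$ and $h=h'$). For $X\subseteq V(G)$, two vertices $a,b$ are $X$-visible if there is a shortest $a,b$-path $P$ in $G$ with $V(P)\cap X\subseteq\{a,b\}$. A set $X$ is a mutual-visibility set if every two vertices of $X$ are $X$-visible; it is maximal if no proper superset is one. $\mu^{ - }(G)$ is the minimum cardinality of a maximal mutual-visibility set of $G$. -}

module Defs where

open import Level using (0ℓ)
open import Data.Nat using (ℕ; zero; suc; _≤_)
open import Data.Fin using (Fin)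
open import Data.Product using (Σ; _×_; _,_)
open import Data.Sum using (_⊎_)
open import Data.List using (List; []; _∷_; length)
open import Data.List.Membership.Propositional using (_∈_)
open import Data.List.Relation.Unary.Unique.Propositional using (Unique)
open import Relation.Binary.PropositionalEquality using (_≡_; _≢_)
open import Relation.Nullary using (¬_)

-- A graph: a vertex type and an (irreflexive, symmetric in our instances) adjacency relation.
record Graph : Set₁ where
  field
    V : Set
    E : V → V → Set
open Graph public

K : ℕ → Graph
K m = record { V = Fin m ; E = λ i j → i ≢ j }

_□_ : Graph → Graph → Graph
G □ H = record
  { V = V G × V H
  ; E = λ { (g , h) (g' , h') → (g ≡ g' × E H h h') ⊎ (E G g g' × h ≡ h') } }

module _ (G : Graph) where

  data Walk : V G → V G → Set where
    [] : ∀ {a} → Walk a a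
    _∷_ : ∀ {a c b} → E G a c → Walk c b → Walk a b

  len : ∀ {a b} → Walk a b → ℕ
  len [] = zero
  len (_ ∷ w) = suc (len w)

  verts : ∀ {a b} → Walk a b → List (V G)
  verts {a} [] = a ∷ []
  verts {a} (_ ∷ w) = a ∷ verts w

  -- a shortest a,b-path (a shortest walk is automatically a path)
  IsShortest : ∀ {a b} → Walk a b → Set
  IsShortest {a} {b} P = ∀ (Q : Walk a b) → len P ≤ len Q

  -- vertex sets are duplicate-free lists; cardinality = length
  VSet : Set
  VSet = List (V G)

  _⊆_ : VSet → VSet → Set
  X ⊆ Y = ∀ {v} → v ∈ X → v ∈ Y

  Visible : VSet → V G → V G → Set
  Visible X a b = Σ (Walk a b) λ P → IsShortest P ×
    (∀ v → v ∈ verts P → v ∈ X → (v ≡ a) ⊎ (v ≡ b))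

  IsMutualVisibility : VSet → Set
  IsMutualVisibility X = ∀ a b → a ∈ X → b ∈ X → Visible X a b

  IsMaximalMV : VSet → Set
  IsMaximalMV X = IsMutualVisibility X ×
    (∀ (Y : VSet) → Unique Y → X ⊆ Y → ¬ (Y ⊆ X) → ¬ IsMutualVisibility Y)

  -- μ⁻(G) = k : k is the minimum cardinality of a maximal mutual-visibility set
  μ⁻≡ : ℕ → Set
  μ⁻≡ k = (Σ VSet λ X → Unique X × IsMaximalMV X × length X ≡ k)
        × (∀ (X : VSet) → Unique X → IsMaximalMV X → k ≤ length X)

-- In the rook's graph K m □ K n two vertices in a common row or column are
-- adjacent, and two vertices (a , b), (c , d) with a ≢ c, b ≢ d are at distance 2,
-- the shortest paths passing through exactly one of the corners (a , d), (c , b).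
-- Hence X is a mutual-visibility set iff it contains no four corners of a
-- rectangle, and a maximal one is saturated: every vertex outside X is the
-- fourth corner of a rectangle whose other three corners lie in X.
-- The cross formed by row 0 and column 0 is maximal and has m + n - 1 vertices.
-- Conversely, in a saturated X each column b has a vertex of X in row 0, or else
-- (b missing row 0) in a row linked to row 0 through some column. Choosing, for
-- every row a ≢ 0, a vertex of X in a column meeting row 0 whenever possible makes
-- the m - 1 row choices and the n column choices pairwise distinct.
module Submission where

open import Defs
open import Data.Nat using (ℕ; zero; suc; _≤_; _+_; _∸_; z≤n; s≤s)
open import Data.Nat.Properties using (+-comm)
open import Data.Fin using (Fin; zero; suc; splitAt; join)
open import Data.Fin.Properties using (any?; injective⇒≤; join-splitAt; suc-injective)
  renaming (_≟_ to _≟ᶠ_)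
open import Data.Product using (∃; ∃₂; _×_; _,_; proj₁; proj₂)
open import Data.Product.Properties using (≡-dec)
open import Data.Sum using (_⊎_; inj₁; inj₂)
open import Data.Empty using (⊥; ⊥-elim)
open import Data.List using (List; []; _∷_; length; _++_; tabulate; lookup)
open import Data.List.Properties using (length-++; length-tabulate)
open import Data.List.Membership.Propositional using (_∈_; _∉_)
open import Data.List.Membership.Propositional.Properties
  using (∈-++⁺ˡ; ∈-++⁺ʳ; ∈-++⁻; ∈-tabulate⁺; ∈-tabulate⁻)
import Data.List.Membership.DecPropositional as DecMembership
open import Data.List.Relation.Unary.Any using (here; there; tail)
open import Data.List.Relation.Unary.Any.Properties using (lookup-index)
import Data.List.Relation.Unary.All as All
open import Data.List.Relation.Unary.AllPairs using (_∷_)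
open import Data.List.Relation.Unary.Unique.Propositional using (Unique)
open import Data.List.Relation.Unary.Unique.Propositional.Properties using (++⁺; tabulate⁺)
open import Function using (_∘_)
open import Function.Definitions using (Injective)
open import Relation.Binary.PropositionalEquality
  using (_≡_; _≢_; refl; sym; trans; cong; cong₂; subst; ≢-sym)
open import Relation.Nullary using (¬_; Dec; yes; no)
open import Relation.Nullary.Decidable using (_×-dec_; ¬?)

length-≥-injective : ∀ {A : Set} {k} {xs : List A} (f : Fin k → A) →
                     Injective _≡_ _≡_ f → (∀ i → f i ∈ xs) → k ≤ length xs
length-≥-injective {xs = xs} f f-injective f∈xs = injective⇒≤ λ {i} {j} eq →
  f-injective (trans (lookup-index (f∈xs i))
                     (trans (cong (lookup xs) eq) (sym (lookup-index (f∈xs j)))))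

splitAt-injective : ∀ m {n} → Injective _≡_ _≡_ (splitAt m {n})
splitAt-injective m {n} {i} {j} eq =
  trans (sym (join-splitAt m n i)) (trans (cong (join m n) eq) (join-splitAt m n j))

module _ (G : Graph) where

  1≤len : ∀ {u v} → u ≢ v → (W : Walk G u v) → 1 ≤ len G W
  1≤len u≢v []      = ⊥-elim (u≢v refl)
  1≤len u≢v (_ ∷ _) = s≤s z≤n

  self-visible : ∀ X u → Visible G X u u
  self-visible X u = [] , (λ _ → z≤n) , λ { _ (here eq) _ → inj₁ eq }

  adjacent-visible : ∀ X {u v} → u ≢ v → E G u v → Visible G X u v
  adjacent-visible X u≢v e = e ∷ [] , 1≤len u≢v ,
    λ { _ (here eq) _ → inj₁ eq ; _ (there (here eq)) _ → inj₂ eq }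

  visible-via : ∀ X {u w v} → E G u w → E G w v → w ∉ X →
                (∀ (W : Walk G u v) → 2 ≤ len G W) → Visible G X u v
  visible-via X e e′ w∉X 2≤len = e ∷ e′ ∷ [] , 2≤len ,
    λ { _ (here eq) _ → inj₁ eq
      ; _ (there (here refl)) w∈X → ⊥-elim (w∉X w∈X)
      ; _ (there (there (here eq))) _ → inj₂ eq }

module _ {m n : ℕ} where

  RectangleFree : List (Fin m × Fin n) → Set
  RectangleFree X = ∀ {a c b d} → a ≢ c → b ≢ d →
    (a , b) ∈ X → (c , d) ∈ X → (a , d) ∈ X → (c , b) ∈ X → ⊥

  2≤len : ∀ {a c b d} → a ≢ c → b ≢ d → (W : Walk (K m □ K n) (a , b) (c , d)) →
          2 ≤ len (K m □ K n) W
  2≤len a≢c b≢d []                          = ⊥-elim (a≢c refl)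
  2≤len a≢c b≢d (inj₁ (refl , _) ∷ [])      = ⊥-elim (a≢c refl)
  2≤len a≢c b≢d (inj₂ (_ , refl) ∷ [])      = ⊥-elim (b≢d refl)
  2≤len a≢c b≢d (_ ∷ _ ∷ _)                 = s≤s (s≤s z≤n)

  short-walk-visits-corner : ∀ {a c b d} → a ≢ c → b ≢ d →
    (W : Walk (K m □ K n) (a , b) (c , d)) → len (K m □ K n) W ≤ 2 →
    (a , d) ∈ verts (K m □ K n) W ⊎ (c , b) ∈ verts (K m □ K n) W
  short-walk-visits-corner a≢c b≢d W _ with 2≤len a≢c b≢d W
  short-walk-visits-corner a≢c b≢d (e ∷ e′ ∷ []) _ | _ = corner e e′
    where
    corner : ∀ {a c b d x y} → E (K m □ K n) (a , b) (x , y) → E (K m □ K n) (x , y) (c , d) →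
             (a , d) ∈ (a , b) ∷ (x , y) ∷ (c , d) ∷ [] ⊎ (c , b) ∈ (a , b) ∷ (x , y) ∷ (c , d) ∷ []
    corner (inj₁ (refl , _)) (inj₁ (refl , _)) = inj₁ (there (there (here refl)))
    corner (inj₁ (refl , _)) (inj₂ (_ , refl)) = inj₁ (there (here refl))
    corner (inj₂ (_ , refl)) (inj₁ (refl , _)) = inj₂ (there (here refl))
    corner (inj₂ (_ , refl)) (inj₂ (_ , refl)) = inj₂ (there (there (here refl)))
  short-walk-visits-corner a≢c b≢d (_ ∷ []) _ | s≤s ()
  short-walk-visits-corner a≢c b≢d (_ ∷ _ ∷ _ ∷ _) (s≤s (s≤s ())) | _

  mutualVisibility⇒rectangleFree : ∀ X → IsMutualVisibility (K m □ K n) X → RectangleFree X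
  mutualVisibility⇒rectangleFree X mv a≢c b≢d ab∈X cd∈X ad∈X cb∈X
    with mv _ _ ab∈X cd∈X
  ... | P , shortest , avoids
    with short-walk-visits-corner a≢c b≢d P
           (shortest (inj₁ (refl , b≢d) ∷ inj₂ (a≢c , refl) ∷ []))
  ... | inj₁ ad∈P with avoids _ ad∈P ad∈X
  ...   | inj₁ eq = b≢d (sym (cong proj₂ eq))
  ...   | inj₂ eq = a≢c (cong proj₁ eq)
  mutualVisibility⇒rectangleFree X mv a≢c b≢d ab∈X cd∈X ad∈X cb∈X
    | P , shortest , avoids | inj₂ cb∈P with avoids _ cb∈P cb∈X
  ...   | inj₁ eq = a≢c (sym (cong proj₁ eq))
  ...   | inj₂ eq = b≢d (cong proj₂ eq)

  _≟_ : (u v : Fin m × Fin n) → Dec (u ≡ v)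
  _≟_ = ≡-dec _≟ᶠ_ _≟ᶠ_

  open DecMembership _≟_ using (_∈?_)

  rectangleFree⇒mutualVisibility : ∀ X → RectangleFree X → IsMutualVisibility (K m □ K n) X
  rectangleFree⇒mutualVisibility X rf (a , b) (c , d) ab∈X cd∈X with a ≟ᶠ c | b ≟ᶠ d
  ... | yes refl | yes refl = self-visible _ X (a , b)
  ... | yes refl | no b≢d   =
    adjacent-visible _ X (b≢d ∘ cong proj₂) (inj₁ (refl , b≢d))
  ... | no a≢c   | yes refl =
    adjacent-visible _ X (a≢c ∘ cong proj₁) (inj₂ (a≢c , refl))
  ... | no a≢c   | no b≢d with (a , d) ∈? X
  ...   | no ad∉X  = visible-via _ X (inj₁ (refl , b≢d)) (inj₂ (a≢c , refl)) ad∉X (2≤len a≢c b≢d)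
  ...   | yes ad∈X = visible-via _ X (inj₂ (a≢c , refl)) (inj₁ (refl , b≢d))
                       (rf a≢c b≢d ab∈X cd∈X ad∈X) (2≤len a≢c b≢d)

  Completion : List (Fin m × Fin n) → Fin m → Fin n → Set
  Completion X a b = ∃₂ λ c d → c ≢ a × d ≢ b × (a , d) ∈ X × (c , b) ∈ X × (c , d) ∈ X

  completion? : ∀ X a b → Dec (Completion X a b)
  completion? X a b = any? λ c → any? λ d →
    ¬? (c ≟ᶠ a) ×-dec ¬? (d ≟ᶠ b) ×-dec (a , d) ∈? X ×-dec (c , b) ∈? X ×-dec (c , d) ∈? X

  Saturated : List (Fin m × Fin n) → Set
  Saturated X = ∀ {a b} → (a , b) ∉ X → Completion X a b

  ∷-rectangleFree : ∀ {X a b} → RectangleFree X → ¬ Completion X a b → RectangleFree ((a , b) ∷ X)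
  ∷-rectangleFree rf ¬completion a≢c b≢d (here refl) q r s =
    ¬completion (_ , _ , ≢-sym a≢c , ≢-sym b≢d , tail (≢-sym b≢d ∘ cong proj₂) r ,
                 tail (≢-sym a≢c ∘ cong proj₁) s , tail (≢-sym a≢c ∘ cong proj₁) q)
  ∷-rectangleFree rf ¬completion a≢c b≢d (there p) (here refl) r s =
    ¬completion (_ , _ , a≢c , b≢d , tail (b≢d ∘ cong proj₂) s ,
                 tail (a≢c ∘ cong proj₁) r , p)
  ∷-rectangleFree rf ¬completion a≢c b≢d (there p) (there q) (here refl) s =
    ¬completion (_ , _ , ≢-sym a≢c , b≢d , p , q , tail (≢-sym a≢c ∘ cong proj₁) s)
  ∷-rectangleFree rf ¬completion a≢c b≢d (there p) (there q) (there r) (here refl) =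
    ¬completion (_ , _ , a≢c , ≢-sym b≢d , q , p , r)
  ∷-rectangleFree rf ¬completion a≢c b≢d (there p) (there q) (there r) (there s) =
    rf a≢c b≢d p q r s

  maximal⇒saturated : ∀ {X} → Unique X → IsMaximalMV (K m □ K n) X → Saturated X
  maximal⇒saturated {X} unique (mv , maximal) {a} {b} ab∉X with completion? X a b
  ... | yes completion = completion
  ... | no ¬completion = ⊥-elim (maximal ((a , b) ∷ X)
          (All.tabulate (λ v∈X ab≡v → ab∉X (subst (_∈ X) (sym ab≡v) v∈X)) ∷ unique)
          there (λ ⊆X → ab∉X (⊆X (here refl)))
          (rectangleFree⇒mutualVisibility _
            (∷-rectangleFree (mutualVisibility⇒rectangleFree X mv) ¬completion)))

module _ {m n : ℕ} where

  row₀ : Fin (suc n) → Fin (suc m) × Fin (suc n)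
  row₀ b = zero , b

  column₀ : Fin m → Fin (suc m) × Fin (suc n)
  column₀ i = suc i , zero

  cross : List (Fin (suc m) × Fin (suc n))
  cross = tabulate row₀ ++ tabulate column₀

  cross-unique : Unique cross
  cross-unique =
    ++⁺ (tabulate⁺ {f = row₀} (cong proj₂)) (tabulate⁺ {f = column₀} (suc-injective ∘ cong proj₁))
      λ (p , q) → case (∈-tabulate⁻ {f = row₀} p) (∈-tabulate⁻ {f = column₀} q)
    where
    case : ∀ {v} → ∃ (λ b → v ≡ (zero , b)) → ∃ (λ i → v ≡ (suc i , zero)) → ⊥
    case (_ , refl) (_ , ())

  length-cross : length cross ≡ m + suc n
  length-cross = trans (length-++ (tabulate row₀))
    (trans (cong₂ _+_ (length-tabulate row₀) (length-tabulate column₀)) (+-comm (suc n) m))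

  ∈-cross⁻ : ∀ {a b} → (a , b) ∈ cross → a ≡ zero ⊎ b ≡ zero
  ∈-cross⁻ p with ∈-++⁻ (tabulate row₀) p
  ... | inj₁ q with ∈-tabulate⁻ {f = row₀} q
  ...   | _ , refl = inj₁ refl
  ∈-cross⁻ p | inj₂ q with ∈-tabulate⁻ {f = column₀} q
  ...   | _ , refl = inj₂ refl

  row₀∈cross : ∀ b → (zero , b) ∈ cross
  row₀∈cross b = ∈-++⁺ˡ (∈-tabulate⁺ {f = row₀} b)

  column₀∈cross : ∀ a → (a , zero) ∈ cross
  column₀∈cross zero    = row₀∈cross zero
  column₀∈cross (suc i) = ∈-++⁺ʳ _ (∈-tabulate⁺ {f = column₀} i)

  cross-rectangleFree : RectangleFree cross
  cross-rectangleFree a≢c b≢d ab∈ cd∈ ad∈ cb∈ with ∈-cross⁻ ab∈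
  ... | inj₁ refl with ∈-cross⁻ cd∈ | ∈-cross⁻ cb∈
  ...   | inj₁ refl | _         = a≢c refl
  ...   | inj₂ refl | inj₁ refl = a≢c refl
  ...   | inj₂ refl | inj₂ refl = b≢d refl
  cross-rectangleFree a≢c b≢d ab∈ cd∈ ad∈ cb∈ | inj₂ refl with ∈-cross⁻ ad∈ | ∈-cross⁻ cd∈
  ...   | inj₂ refl | _         = b≢d refl
  ...   | inj₁ refl | inj₁ refl = a≢c refl
  ...   | inj₁ refl | inj₂ refl = b≢d refl

  rectangleFree-⊇cross⇒⊆cross : ∀ {Y} → RectangleFree Y →
    (∀ {v} → v ∈ cross → v ∈ Y) → ∀ {v} → v ∈ Y → v ∈ cross
  rectangleFree-⊇cross⇒⊆cross rf cross⊆Y {zero , b}        _ = row₀∈cross b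
  rectangleFree-⊇cross⇒⊆cross rf cross⊆Y {suc i , zero}    _ = column₀∈cross (suc i)
  rectangleFree-⊇cross⇒⊆cross rf cross⊆Y {suc i , suc j} v∈Y = ⊥-elim
    (rf (λ ()) (λ ()) v∈Y (cross⊆Y (row₀∈cross zero))
        (cross⊆Y (column₀∈cross (suc i))) (cross⊆Y (row₀∈cross (suc j))))

  cross-maximal : IsMaximalMV (K (suc m) □ K (suc n)) cross
  cross-maximal = rectangleFree⇒mutualVisibility cross cross-rectangleFree ,
    λ Y _ cross⊆Y Y⊈cross mv → Y⊈cross
      (rectangleFree-⊇cross⇒⊆cross (mutualVisibility⇒rectangleFree Y mv) cross⊆Y)

module _ {m n : ℕ} {X : List (Fin (suc m) × Fin (suc n))} (saturated : Saturated X) where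

  open DecMembership (_≟_ {suc m} {suc n}) using (_∈?_)

  Anchored : Fin (suc n) → Set
  Anchored d = (zero , d) ∈ X

  Linked : Fin (suc m) → Set
  Linked a = ∃ λ d → (a , d) ∈ X × Anchored d

  row-meets : ∀ a → ∃ λ d → (a , d) ∈ X
  row-meets a with (a , zero) ∈? X
  ... | yes a0∈X = zero , a0∈X
  ... | no a0∉X with saturated a0∉X
  ...   | _ , d , _ , _ , ad∈X , _ = d , ad∈X

  ColumnRep : Fin (suc n) → Set
  ColumnRep b = ∃ λ a → (a , b) ∈ X × (a ≡ zero ⊎ ¬ Anchored b × Linked a)

  RowRep : Fin (suc m) → Set
  RowRep a = ∃ λ d → (a , d) ∈ X × (Anchored d ⊎ ¬ Linked a)

  columnRep : ∀ b → ColumnRep b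
  columnRep b with (zero , b) ∈? X
  ... | yes 0b∈X = zero , 0b∈X , inj₁ refl
  ... | no 0b∉X with saturated 0b∉X
  ...   | c , d , _ , _ , 0d∈X , cb∈X , cd∈X = c , cb∈X , inj₂ (0b∉X , d , cd∈X , 0d∈X)

  rowRep : ∀ a → RowRep a
  rowRep a with any? (λ d → (a , d) ∈? X ×-dec (zero , d) ∈? X)
  ... | yes (d , ad∈X , 0d∈X) = d , ad∈X , inj₁ 0d∈X
  ... | no ¬linked with row-meets a
  ...   | d , ad∈X = d , ad∈X , inj₂ ¬linked

  rowRep≢columnRep : ∀ {i b} (r : RowRep (suc i)) (c : ColumnRep b) →
                     (suc i , proj₁ r) ≢ (proj₁ c , b)
  rowRep≢columnRep _ (_ , _ , inj₁ refl) ()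
  rowRep≢columnRep (_ , _ , inj₁ 0b∈X) (_ , _ , inj₂ (0b∉X , _)) refl = 0b∉X 0b∈X
  rowRep≢columnRep (_ , _ , inj₂ ¬linked) (_ , _ , inj₂ (_ , linked)) refl = ¬linked linked

  representative : Fin m ⊎ Fin (suc n) → Fin (suc m) × Fin (suc n)
  representative (inj₁ i) = suc i , proj₁ (rowRep (suc i))
  representative (inj₂ b) = proj₁ (columnRep b) , b

  representative-∈ : ∀ x → representative x ∈ X
  representative-∈ (inj₁ i) = proj₁ (proj₂ (rowRep (suc i)))
  representative-∈ (inj₂ b) = proj₁ (proj₂ (columnRep b))

  representative-injective : Injective _≡_ _≡_ representative
  representative-injective {inj₁ i} {inj₁ j} eq = cong inj₁ (suc-injective (cong proj₁ eq))
  representative-injective {inj₂ b} {inj₂ c} eq = cong inj₂ (cong proj₂ eq)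
  representative-injective {inj₁ i} {inj₂ b} eq =
    ⊥-elim (rowRep≢columnRep (rowRep (suc i)) (columnRep b) eq)
  representative-injective {inj₂ b} {inj₁ i} eq =
    ⊥-elim (rowRep≢columnRep (rowRep (suc i)) (columnRep b) (sym eq))

  saturated⇒length≥ : m + suc n ≤ length X
  saturated⇒length≥ = length-≥-injective (representative ∘ splitAt m)
    (λ eq → splitAt-injective m (representative-injective eq))
    (λ k → representative-∈ (splitAt m k))

corollary2p7 : (m n : ℕ) → 1 ≤ m → 1 ≤ n → μ⁻≡ (K m □ K n) (m + n ∸ 1)
-- Here m + n ∸ 1 reduces to m + suc n, the bound of saturated⇒length≥.
corollary2p7 (suc m) (suc n) _ _ =
  (cross , cross-unique , cross-maximal , length-cross) ,
  λ X unique maximal → saturated⇒length≥ (maximal⇒saturated unique maximal)
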